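{- Let $f\in F(n)$ contain $2P_1$, i.e. suppose there exist configurations $x,y$ such that $x,y,f(x),f(y)$ are pairwise distinct. Then there exists $h\in F(n)$ with $h\sim f$ and $|\Delta^+(h)|\neq|\Delta^+(f)|$.
   Context: $F(n)$ is the set of all functions $\{0,1\}^n\to\{0,1\}^n$. For a configuration $x$, $\bar x$ is obtained by flipping every component. $\Delta^+(f)=\{x\in\{0,1\}^n: f(x)=\bar x\}$ (equivalently, the configurations of out-degree $n$ in the asynchronous graph of $f$). $\mathcal{S}(f)$ is the digraph on $\{0,1\}^n$ with an arc $x\to f(x)$; $f\sim h$ means $\mathcal{S}(f)$ and $\mathcal{S}(h)$ are isomorphic. -}

module Defs where

open import Data.Bool using (Bool; true; false; not)
open import Data.Nat using (ℕ; zero; suc)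
open import Data.Vec using (Vec; []; _∷_; map)
open import Data.List using (List; []; _∷_; _++_; filter; length)
import Data.List as L
open import Data.Vec.Properties using (≡-dec)
open import Data.Bool.Properties using (_≟_)
open import Relation.Binary.PropositionalEquality using (_≡_)
open import Relation.Nullary using (Dec)
open import Function.Bundles using (_↔_; Inverse)
open import Data.Product using (Σ)

Config : ℕ → Set
Config n = Vec Bool n

F : ℕ → Set
F n = Config n → Config n

flipAll : ∀ {n} → Config n → Config n
flipAll = map not

_≟C_ : ∀ {n} (x y : Config n) → Dec (x ≡ y)
_≟C_ = ≡-dec _≟_

allConfigs : (n : ℕ) → List (Config n)
allConfigs zero = [] ∷ []
allConfigs (suc n) = L.map (false ∷_) (allConfigs n) ++ L.map (true ∷_) (allConfigs n)

Δ⁺ : ∀ {n} → F n → List (Config n)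
Δ⁺ {n} f = filter (λ x → f x ≟C flipAll x) (allConfigs n)

card-Δ⁺ : ∀ {n} → F n → ℕ
card-Δ⁺ f = length (Δ⁺ f)

-- f ∼ h : the digraphs S(f) (arcs x → f x) and S(h) are isomorphic,
-- i.e. there is a bijection π of {0,1}^n with π (f x) ≡ h (π x) for all x.
_∼_ : ∀ {n} → F n → F n → Set
_∼_ {n} f h = Σ (Config n ↔ Config n) (λ π → ∀ x → Inverse.to π (f x) ≡ h (Inverse.to π x))

{-# OPTIONS --safe #-}
-- Conjugating a map by a transposition (u v) can change the membership in Δ⁺ only of
-- u, v, ū, v̄, so two conjugates can be compared on these four points alone.  Two such
-- conjugations turn f into a map g with x, y ∈ Δ⁺(g) and x, x̄, y, ȳ pairwise distinct.
-- Conjugating g by (x y), or by (x ȳ) when g(ȳ) = x, leaves at most x̄ of these four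
-- points in Δ⁺, whereas g has at least x and y there.  So |Δ⁺| takes two different
-- values on the conjugacy class of f, and one of them differs from |Δ⁺(f)|.
module Submission where

open import Defs
open import Data.Bool using (true; false; not)
open import Data.Bool.Properties using (not-involutive; not-¬)
open import Data.Empty using (⊥-elim)
open import Data.List using (List; []; _∷_; filter; length)
import Data.List as List
open import Data.List.Membership.Propositional using (_∈_)
open import Data.List.Membership.Propositional.Properties
  using (∈-map⁺; ∈-map⁻; ∈-++⁺ˡ; ∈-++⁺ʳ; ∈-filter⁺; ∈-filter⁻)
open import Data.List.Relation.Unary.Any using (here; there)
open import Data.List.Relation.Unary.All using (All; []; _∷_)
import Data.List.Relation.Unary.All as All
open import Data.List.Relation.Unary.All.Properties using (all-filter)
open import Data.List.Relation.Unary.AllPairs using ([]; _∷_)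
open import Data.List.Relation.Unary.Unique.Propositional using (Unique)
import Data.List.Relation.Unary.Unique.Propositional.Properties as Unique
open import Data.Nat using (ℕ; zero; suc; _+_; _≤_; z≤n; s≤s)
open import Data.Nat.Properties using (_≟_; +-suc; +-cancelʳ-≡; m≤n⇒m≤1+n; ≤-trans; n≮n)
open import Data.Product using (Σ; _×_; _,_; proj₂)
open import Data.Sum using (_⊎_; inj₁; inj₂)
open import Data.Vec using ([]; _∷_; head)
open import Data.Vec.Properties using (map-∘; map-cong; map-id; ∷-injectiveʳ)
open import Function using (_∘_)
open import Function.Bundles using (_↔_; Inverse; mk↔ₛ′; _⇔_; mk⇔; Equivalence)
open import Function.Construct.Composition using (_↔-∘_)
open import Level using (Level)
open import Relation.Binary.Definitions using (DecidableEquality)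
open import Relation.Binary.PropositionalEquality
open import Relation.Nullary using (yes; no; ¬_; _⊎-dec_)
open import Relation.Unary using (Pred; Decidable)
open import Relation.Unary.Properties using (∁?)

private
  variable
    a p q r : Level
    A : Set a

∈⇒1≤length : ∀ {x : A} {xs} → x ∈ xs → 1 ≤ length xs
∈⇒1≤length (here _)  = s≤s z≤n
∈⇒1≤length (there _) = s≤s z≤n

≢-∈⇒2≤length : ∀ {x y : A} {xs} → x ∈ xs → y ∈ xs → x ≢ y → 2 ≤ length xs
≢-∈⇒2≤length (here refl) (here refl) x≢y = ⊥-elim (x≢y refl)
≢-∈⇒2≤length (here refl) (there y∈) _    = s≤s (∈⇒1≤length y∈)
≢-∈⇒2≤length (there x∈) (here refl) _    = s≤s (∈⇒1≤length x∈)
≢-∈⇒2≤length (there x∈) (there y∈) x≢y  = m≤n⇒m≤1+n (≢-∈⇒2≤length x∈ y∈ x≢y)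

Unique-constant⇒length≤1 : ∀ {c : A} {xs} → Unique xs → (∀ {z} → z ∈ xs → z ≡ c) → length xs ≤ 1
Unique-constant⇒length≤1 {xs = []}        _                   _   = z≤n
Unique-constant⇒length≤1 {xs = _ ∷ []}    _                   _   = s≤s z≤n
Unique-constant⇒length≤1 {xs = _ ∷ _ ∷ _} ((z≢w ∷ _) ∷ _) ≡c =
  ⊥-elim (z≢w (trans (≡c (here refl)) (sym (≡c (there (here refl))))))

count : {P : Pred A p} → Decidable P → List A → ℕ
count P? = length ∘ filter P?

count-split : {P : Pred A p} {R : Pred A r} (P? : Decidable P) (R? : Decidable R) (xs : List A) →
              count P? xs ≡ count P? (filter R? xs) + count P? (filter (∁? R?) xs)
count-split P? R? [] = refl
count-split P? R? (x ∷ xs) with R? x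
... | yes _ with P? x
...   | yes _ = cong suc (count-split P? R? xs)
...   | no _  = count-split P? R? xs
count-split P? R? (x ∷ xs) | no _ with P? x
...   | yes _ = trans (cong suc (count-split P? R? xs)) (sym (+-suc _ _))
...   | no _  = count-split P? R? xs

module _ {P : Pred A p} {Q : Pred A q} (P? : Decidable P) (Q? : Decidable Q) where

  count-cong : ∀ {xs} → All (λ z → P z ⇔ Q z) xs → count P? xs ≡ count Q? xs
  count-cong [] = refl
  count-cong {x ∷ _} (P⇔Q ∷ rest) with P? x | Q? x
  ... | yes _  | yes _  = cong suc (count-cong rest)
  ... | yes px | no ¬qx = ⊥-elim (¬qx (Equivalence.to P⇔Q px))
  ... | no ¬px | yes qx = ⊥-elim (¬px (Equivalence.from P⇔Q qx))
  ... | no _   | no _   = count-cong rest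

  count-localise : {R : Pred A r} (R? : Decidable R) (xs : List A) →
                   (∀ {z} → ¬ R z → P z ⇔ Q z) →
                   count P? xs ≡ count Q? xs →
                   count P? (filter R? xs) ≡ count Q? (filter R? xs)
  count-localise R? xs agree P≡Q = +-cancelʳ-≡ _ _ _ (begin
    count P? (filter R? xs) + count P? (filter (∁? R?) xs) ≡⟨ count-split P? R? xs ⟨
    count P? xs                                            ≡⟨ P≡Q ⟩
    count Q? xs                                            ≡⟨ count-split Q? R? xs ⟩
    count Q? (filter R? xs) + count Q? (filter (∁? R?) xs) ≡⟨ cong (count Q? (filter R? xs) +_) outside ⟨
    count Q? (filter R? xs) + count P? (filter (∁? R?) xs) ∎)
    where
    open ≡-Reasoning
    outside : count P? (filter (∁? R?) xs) ≡ count Q? (filter (∁? R?) xs)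
    outside = count-cong (All.map agree (all-filter (∁? R?) xs))

module Transposition (_≟ᴬ_ : DecidableEquality A) where

  swap : A → A → A → A
  swap u v z with z ≟ᴬ u
  ... | yes _ = v
  ... | no _ with z ≟ᴬ v
  ...   | yes _ = u
  ...   | no _  = z

  swap-≡ˡ : ∀ u v → swap u v u ≡ v
  swap-≡ˡ u v with u ≟ᴬ u
  ... | yes _   = refl
  ... | no u≢u = ⊥-elim (u≢u refl)

  swap-≡ʳ : ∀ u v → swap u v v ≡ u
  swap-≡ʳ u v with v ≟ᴬ u
  ... | yes v≡u = v≡u
  ... | no _ with v ≟ᴬ v
  ...   | yes _   = refl
  ...   | no v≢v = ⊥-elim (v≢v refl)

  swap-fixes : ∀ {u v z} → z ≢ u → z ≢ v → swap u v z ≡ z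
  swap-fixes {u} {v} {z} z≢u z≢v with z ≟ᴬ u
  ... | yes z≡u = ⊥-elim (z≢u z≡u)
  ... | no _ with z ≟ᴬ v
  ...   | yes z≡v = ⊥-elim (z≢v z≡v)
  ...   | no _    = refl

  swap-involutive : ∀ u v z → swap u v (swap u v z) ≡ z
  swap-involutive u v z with z ≟ᴬ u
  ... | yes z≡u = trans (swap-≡ʳ u v) (sym z≡u)
  ... | no z≢u with z ≟ᴬ v
  ...   | yes z≡v = trans (swap-≡ˡ u v) (sym z≡v)
  ...   | no z≢v  = swap-fixes z≢u z≢v

  swap-injective : ∀ u v {z w} → swap u v z ≡ swap u v w → z ≡ w
  swap-injective u v {z} {w} eq =
    trans (sym (swap-involutive u v z)) (trans (cong (swap u v) eq) (swap-involutive u v w))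

  swap-↔ : A → A → A ↔ A
  swap-↔ u v = mk↔ₛ′ (swap u v) (swap u v) (swap-involutive u v) (swap-involutive u v)

  conj : A → A → (A → A) → A → A
  conj u v g = swap u v ∘ g ∘ swap u v

flipAll-involutive : ∀ {n} (z : Config n) → flipAll (flipAll z) ≡ z
flipAll-involutive z = trans (sym (map-∘ not not z)) (trans (map-cong not-involutive z) (map-id z))

flipAll-transpose : ∀ {n} {z w : Config n} → flipAll z ≡ w → z ≡ flipAll w
flipAll-transpose {z = z} refl = sym (flipAll-involutive z)

flipAll-injective : ∀ {n} {z w : Config n} → flipAll z ≡ flipAll w → z ≡ w
flipAll-injective {w = w} eq = trans (flipAll-transpose eq) (flipAll-involutive w)

≢-flipAll : ∀ {n} (z : Config (suc n)) → z ≢ flipAll z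
≢-flipAll (b ∷ _) eq = not-¬ refl (cong head eq)

allConfigs-complete : ∀ {n} (z : Config n) → z ∈ allConfigs n
allConfigs-complete [] = here refl
allConfigs-complete (false ∷ z) = ∈-++⁺ˡ (∈-map⁺ (false ∷_) (allConfigs-complete z))
allConfigs-complete {suc n} (true ∷ z) =
  ∈-++⁺ʳ (List.map (false ∷_) (allConfigs n)) (∈-map⁺ (true ∷_) (allConfigs-complete z))

allConfigs-unique : ∀ n → Unique (allConfigs n)
allConfigs-unique zero = [] ∷ []
allConfigs-unique (suc n) =
  Unique.++⁺ (Unique.map⁺ ∷-injectiveʳ (allConfigs-unique n))
             (Unique.map⁺ ∷-injectiveʳ (allConfigs-unique n))
             false≢true
  where
  false≢true : ∀ {z} → ¬ (z ∈ List.map (false ∷_) (allConfigs n) × z ∈ List.map (true ∷_) (allConfigs n))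
  false≢true (z∈₀ , z∈₁) with ∈-map⁻ (false ∷_) z∈₀ | ∈-map⁻ (true ∷_) z∈₁
  ... | _ , _ , refl | _ , _ , ()

FlipsAt : ∀ {n} → F n → Config n → Set
FlipsAt g z = g z ≡ flipAll z

flipsAt? : ∀ {n} (g : F n) → Decidable (FlipsAt g)
flipsAt? g z = g z ≟C flipAll z

Δ⁺-Varies : ∀ {n} → F n → Set
Δ⁺-Varies {n} f = Σ (F n) λ h → (f ∼ h) × (card-Δ⁺ h ≢ card-Δ⁺ f)

∼-trans : ∀ {n} {f g h : F n} → f ∼ g → g ∼ h → f ∼ h
∼-trans (π , πf≡gπ) (σ , σg≡hσ) =
  σ ↔-∘ π , λ x → trans (cong (Inverse.to σ) (πf≡gπ x)) (σg≡hσ _)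

∼-Δ⁺-Varies : ∀ {n} {f g : F n} → f ∼ g → Δ⁺-Varies g → Δ⁺-Varies f
∼-Δ⁺-Varies {f = f} {g} f∼g (h , g∼h , h≢g) with card-Δ⁺ g ≟ card-Δ⁺ f
... | no g≢f  = g , f∼g , g≢f
... | yes g≡f = h , ∼-trans {h = h} f∼g g∼h , λ h≡f → h≢g (trans h≡f (sym g≡f))

module _ {n : ℕ} where

  open Transposition (_≟C_ {n})

  conj-∼ : ∀ u v (g : F n) → g ∼ conj u v g
  conj-∼ u v g = swap-↔ u v , λ x → cong (swap u v ∘ g) (sym (swap-involutive u v x))

  Touched : Config n → Config n → Config n → Set
  Touched u v z = z ≡ u ⊎ z ≡ v ⊎ flipAll z ≡ u ⊎ flipAll z ≡ v

  touched? : ∀ u v → Decidable (Touched u v)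
  touched? u v z = z ≟C u ⊎-dec z ≟C v ⊎-dec flipAll z ≟C u ⊎-dec flipAll z ≟C v

  touchedConfigs : Config n → Config n → List (Config n)
  touchedConfigs u v = filter (touched? u v) (allConfigs n)

  conj-flipsAt⇔ : ∀ u v (g : F n) {z} → ¬ Touched u v z → FlipsAt (conj u v g) z ⇔ FlipsAt g z
  conj-flipsAt⇔ u v g {z} untouched = mk⇔
    (λ hz → swap-injective u v (begin
      swap u v (g z)        ≡⟨ cong (swap u v ∘ g) σz ⟨
      conj u v g z          ≡⟨ hz ⟩
      flipAll z             ≡⟨ σz̄ ⟨
      swap u v (flipAll z)  ∎))
    (λ gz → begin
      conj u v g z          ≡⟨ cong (swap u v ∘ g) σz ⟩
      swap u v (g z)        ≡⟨ cong (swap u v) gz ⟩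
      swap u v (flipAll z)  ≡⟨ σz̄ ⟩
      flipAll z             ∎)
    where
    open ≡-Reasoning
    σz : swap u v z ≡ z
    σz = swap-fixes (untouched ∘ inj₁) (untouched ∘ inj₂ ∘ inj₁)
    σz̄ : swap u v (flipAll z) ≡ flipAll z
    σz̄ = swap-fixes (untouched ∘ inj₂ ∘ inj₂ ∘ inj₁) (untouched ∘ inj₂ ∘ inj₂ ∘ inj₂)

  conj-card-localise : ∀ u v (g : F n) → card-Δ⁺ (conj u v g) ≡ card-Δ⁺ g →
    count (flipsAt? (conj u v g)) (touchedConfigs u v) ≡ count (flipsAt? g) (touchedConfigs u v)
  conj-card-localise u v g =
    count-localise (flipsAt? (conj u v g)) (flipsAt? g) (touched? u v) (allConfigs n) (conj-flipsAt⇔ u v g)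

module _ {n : ℕ} where

  open Transposition (_≟C_ {suc n})
  open ≡-Reasoning

  conj-flipsAt-new : ∀ (g : F (suc n)) {z} → z ≢ g z → FlipsAt (conj (g z) (flipAll z) g) z
  conj-flipsAt-new g {z} z≢gz = begin
    swap (g z) (flipAll z) (g (swap (g z) (flipAll z) z)) ≡⟨ cong (swap _ _ ∘ g) (swap-fixes z≢gz (≢-flipAll z)) ⟩
    swap (g z) (flipAll z) (g z)                          ≡⟨ swap-≡ˡ (g z) (flipAll z) ⟩
    flipAll z                                             ∎

  swap-fixes-flipAllˡ : ∀ {u v} → u ≢ flipAll v → swap u v (flipAll u) ≡ flipAll u
  swap-fixes-flipAllˡ {u} u≢v̄ = swap-fixes (≢-flipAll u ∘ sym) (u≢v̄ ∘ flipAll-transpose)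

  swap-fixes-flipAllʳ : ∀ {u v} → u ≢ flipAll v → swap u v (flipAll v) ≡ flipAll v
  swap-fixes-flipAllʳ {v = v} u≢v̄ = swap-fixes (u≢v̄ ∘ sym) (≢-flipAll v ∘ sym)

  conj-flipsAt-touched : ∀ (g : F (suc n)) {u v z} → u ≢ v → u ≢ flipAll v →
    FlipsAt g u → g v ≢ flipAll u → g (flipAll v) ≢ u →
    Touched u v z → FlipsAt (conj u v g) z → z ≡ flipAll u
  conj-flipsAt-touched g {u} {v} u≢v u≢v̄ gu gv≢ū gv̄≢u (inj₁ refl) hz =
    ⊥-elim (gv≢ū (swap-injective u v (begin
      swap u v (g v)        ≡⟨ cong (swap u v ∘ g) (swap-≡ˡ u v) ⟨
      conj u v g u          ≡⟨ hz ⟩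
      flipAll u             ≡⟨ swap-fixes-flipAllˡ u≢v̄ ⟨
      swap u v (flipAll u)  ∎)))
  conj-flipsAt-touched g {u} {v} u≢v u≢v̄ gu gv≢ū gv̄≢u (inj₂ (inj₁ refl)) hz =
    ⊥-elim (u≢v (flipAll-injective (begin
      flipAll u             ≡⟨ swap-fixes-flipAllˡ u≢v̄ ⟨
      swap u v (flipAll u)  ≡⟨ cong (swap u v) gu ⟨
      swap u v (g u)        ≡⟨ cong (swap u v ∘ g) (swap-≡ʳ u v) ⟨
      conj u v g v          ≡⟨ hz ⟩
      flipAll v             ∎)))
  conj-flipsAt-touched g u≢v u≢v̄ gu gv≢ū gv̄≢u (inj₂ (inj₂ (inj₁ z̄≡u))) hz =
    flipAll-transpose z̄≡u
  conj-flipsAt-touched g {u} {v} u≢v u≢v̄ gu gv≢ū gv̄≢u (inj₂ (inj₂ (inj₂ z̄≡v))) hz =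
    ⊥-elim (gv̄≢u (swap-injective u v (begin
      swap u v (g (flipAll v))  ≡⟨ cong (swap u v ∘ g) (swap-fixes-flipAllʳ u≢v̄) ⟨
      conj u v g (flipAll v)    ≡⟨ subst (FlipsAt (conj u v g)) (flipAll-transpose z̄≡v) hz ⟩
      flipAll (flipAll v)       ≡⟨ flipAll-involutive v ⟩
      v                         ≡⟨ swap-≡ˡ u v ⟨
      swap u v u                ∎)))

  conj-changes-card : ∀ (g : F (suc n)) {u v w} → u ≢ v → u ≢ flipAll v →
    FlipsAt g u → g v ≢ flipAll u → g (flipAll v) ≢ u →
    Touched u v w → w ≢ u → FlipsAt g w → card-Δ⁺ (conj u v g) ≢ card-Δ⁺ g
  conj-changes-card g {u} {v} u≢v u≢v̄ gu gv≢ū gv̄≢u touched-w w≢u gw h≡g =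
    n≮n 1 (≤-trans at-least-two (subst (_≤ 1) (conj-card-localise u v g h≡g) at-most-one))
    where
    h = conj u v g

    flipping-touched : ∀ {z} → Touched u v z → FlipsAt g z → z ∈ filter (flipsAt? g) (touchedConfigs u v)
    flipping-touched tz gz =
      ∈-filter⁺ (flipsAt? g) (∈-filter⁺ (touched? u v) (allConfigs-complete _) tz) gz

    at-least-two : 2 ≤ count (flipsAt? g) (touchedConfigs u v)
    at-least-two = ≢-∈⇒2≤length (flipping-touched touched-w gw) (flipping-touched (inj₁ refl) gu) w≢u

    only-ū : ∀ {z} → z ∈ filter (flipsAt? h) (touchedConfigs u v) → z ≡ flipAll u
    only-ū z∈ with z∈touched , hz ← ∈-filter⁻ (flipsAt? h) {xs = touchedConfigs u v} z∈ =
      conj-flipsAt-touched g u≢v u≢v̄ gu gv≢ū gv̄≢u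
        (proj₂ (∈-filter⁻ (touched? u v) {xs = allConfigs (suc n)} z∈touched)) hz

    at-most-one : count (flipsAt? h) (touchedConfigs u v) ≤ 1
    at-most-one = Unique-constant⇒length≤1
      (Unique.filter⁺ (flipsAt? h) (Unique.filter⁺ (touched? u v) (allConfigs-unique (suc n)))) only-ū

  flipping-pair⇒Δ⁺-Varies : ∀ (g : F (suc n)) {x y} → x ≢ y → x ≢ flipAll y →
    FlipsAt g x → FlipsAt g y → Δ⁺-Varies g
  flipping-pair⇒Δ⁺-Varies g {x} {y} x≢y x≢ȳ gx gy with g (flipAll y) ≟C x
  ... | no gȳ≢x =
    conj x y g , conj-∼ x y g ,
    conj-changes-card g x≢y x≢ȳ gx gy≢x̄ gȳ≢x (inj₂ (inj₁ refl)) (x≢y ∘ sym) gy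
    where
    gy≢x̄ : g y ≢ flipAll x
    gy≢x̄ gy≡x̄ = x≢y (flipAll-injective (trans (sym gy≡x̄) gy))
  ... | yes gȳ≡x =
    conj x (flipAll y) g , conj-∼ x (flipAll y) g ,
    conj-changes-card g x≢ȳ x≢ȳ̄ gx gȳ≢x̄ gȳ̄≢x (inj₂ (inj₂ (inj₂ refl))) (x≢y ∘ sym) gy
    where
    x≢ȳ̄ : x ≢ flipAll (flipAll y)
    x≢ȳ̄ = subst (x ≢_) (sym (flipAll-involutive y)) x≢y
    gȳ≢x̄ : g (flipAll y) ≢ flipAll x
    gȳ≢x̄ gȳ≡x̄ = ≢-flipAll x (trans (sym gȳ≡x) gȳ≡x̄)
    gȳ̄≢x : g (flipAll (flipAll y)) ≢ x
    gȳ̄≢x gȳ̄≡x = x≢ȳ (trans (sym gȳ̄≡x) (trans (cong g (flipAll-involutive y)) gy))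

  normalise : ∀ (f : F (suc n)) {x y} →
    x ≢ y → x ≢ f x → x ≢ f y → y ≢ f x → y ≢ f y → f x ≢ f y →
    Σ (F (suc n)) λ g → (f ∼ g) × Σ (Config (suc n)) λ y′ →
      x ≢ y′ × x ≢ flipAll y′ × FlipsAt g x × FlipsAt g y′
  normalise f {x} {y} x≢y x≢fx x≢fy y≢fx y≢fy fx≢fy =
    g₂ , ∼-trans {h = g₂} (conj-∼ (f x) (flipAll x) f) (conj-∼ (g₁ y₁) (flipAll y₁) g₁) ,
    y₁ , x≢y₁ , x≢ȳ₁ , g₂x , conj-flipsAt-new g₁ y₁≢g₁y₁
    where
    σ₁ = swap (f x) (flipAll x)
    g₁ = conj (f x) (flipAll x) f
    y₁ = σ₁ y
    g₂ = conj (g₁ y₁) (flipAll y₁) g₁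

    σ₁-≢ : ∀ {z w} → z ≢ w → σ₁ z ≢ σ₁ w
    σ₁-≢ z≢w = z≢w ∘ swap-injective (f x) (flipAll x)

    σ₁x : σ₁ x ≡ x
    σ₁x = swap-fixes x≢fx (≢-flipAll x)

    σ₁fx : σ₁ (f x) ≡ flipAll x
    σ₁fx = swap-≡ˡ (f x) (flipAll x)

    g₁y₁ : g₁ y₁ ≡ σ₁ (f y)
    g₁y₁ = cong (σ₁ ∘ f) (swap-involutive (f x) (flipAll x) y)

    x≢y₁ : x ≢ y₁
    x≢y₁ = subst (_≢ y₁) σ₁x (σ₁-≢ x≢y)

    x̄≢y₁ : flipAll x ≢ y₁
    x̄≢y₁ = subst (_≢ y₁) σ₁fx (σ₁-≢ (y≢fx ∘ sym))

    x≢ȳ₁ : x ≢ flipAll y₁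
    x≢ȳ₁ x≡ȳ₁ = x̄≢y₁ (sym (flipAll-transpose (sym x≡ȳ₁)))

    y₁≢g₁y₁ : y₁ ≢ g₁ y₁
    y₁≢g₁y₁ = subst (y₁ ≢_) (sym g₁y₁) (σ₁-≢ y≢fy)

    x-untouched : ¬ Touched (g₁ y₁) (flipAll y₁) x
    x-untouched (inj₁ x≡g₁y₁)        = subst₂ _≢_ σ₁x (sym g₁y₁) (σ₁-≢ x≢fy) x≡g₁y₁
    x-untouched (inj₂ (inj₁ x≡ȳ₁))   = x≢ȳ₁ x≡ȳ₁
    x-untouched (inj₂ (inj₂ (inj₁ x̄≡g₁y₁))) =
      subst₂ _≢_ σ₁fx (sym g₁y₁) (σ₁-≢ fx≢fy) x̄≡g₁y₁
    x-untouched (inj₂ (inj₂ (inj₂ x̄≡ȳ₁))) = x≢y₁ (flipAll-injective x̄≡ȳ₁)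

    g₂x : FlipsAt g₂ x
    g₂x = Equivalence.from (conj-flipsAt⇔ (g₁ y₁) (flipAll y₁) g₁ x-untouched)
                           (conj-flipsAt-new f x≢fx)

lemma6 : (n : ℕ) (f : F n) →
         (Σ (Config n) λ x → Σ (Config n) λ y →
            x ≢ y × x ≢ f x × x ≢ f y × y ≢ f x × y ≢ f y × f x ≢ f y) →
         Σ (F n) λ h → (f ∼ h) × (card-Δ⁺ h ≢ card-Δ⁺ f)
lemma6 zero f ([] , [] , x≢y , _) = ⊥-elim (x≢y refl)
lemma6 (suc n) f (x , y , x≢y , x≢fx , x≢fy , y≢fx , y≢fy , fx≢fy)
  with g , f∼g , y′ , x≢y′ , x≢ȳ′ , gx , gy′ ← normalise f x≢y x≢fx x≢fy y≢fx y≢fy fx≢fy =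
  ∼-Δ⁺-Varies f∼g (flipping-pair⇒Δ⁺-Varies g x≢y′ x≢ȳ′ gx gy′)
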